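{- Let $\mathsf{poly}$ be the inductive type with constructors $\mathsf{cst}:\mathbb{N}\to\mathsf{poly}$, $\mathsf{var}:\mathbb{N}\to\mathsf{poly}$, $\mathsf{add}:\mathsf{poly}\to\mathsf{poly}\to\mathsf{poly}$, $\mathsf{mul}:\mathsf{poly}\to\mathsf{poly}\to\mathsf{poly}$, and let $\mathsf{eval}:\mathsf{poly}\to\mathsf{list}\,\mathbb{N}\to\mathbb{N}$ be given by $\mathsf{eval}(\mathsf{cst}\,n)\,S=n$, $\mathsf{eval}(\mathsf{var}\,n)\,S=$ the $n$-th element of $S$ (indexing from $0$), or $0$ if $S$ has length at most $n$, $\mathsf{eval}(\mathsf{add}\,p_1\,p_2)\,S=\mathsf{eval}\,p_1\,S+\mathsf{eval}\,p_2\,S$, $\mathsf{eval}(\mathsf{mul}\,p_1\,p_2)\,S=\mathsf{eval}\,p_1\,S\cdot\mathsf{eval}\,p_2\,S$. Let $\mathsf{H10}:\mathsf{poly}\times\mathsf{poly}\to\mathrm{Prop}$ be $\mathsf{H10}(p_1,p_2):=\exists S:\mathsf{list}\,\mathbb{N}.\ \mathsf{eval}\,p_1\,S=\mathsf{eval}\,p_2\,S$. Then $\mathsf{H10}$ is L-enumerable.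
   Context: The weak call-by-value $\lambda$-calculus L has terms $\mathbf{T}$ given by $s,t ::= n \mid s\,t \mid \lambda s$ ($n$ a natural number, de Bruijn indices). Substitution $s[k:=u]$: $k[k:=u]=u$, $n[k:=u]=n$ for $n\neq k$, $(st)[k:=u]=(s[k:=u])(t[k:=u])$, $(\lambda s)[k:=u]=\lambda(s[k+1:=u])$. Reduction $\succ$ is the least relation with $(\lambda s)(\lambda t)\succ s[0:=\lambda t]$, $s\succ s' \Rightarrow st\succ s't$, $t\succ t'\Rightarrow st\succ st'$; $\succ^*$ is its reflexive transitive closure. A procedure is a closed abstraction. Encodings are Scott encodings: for an inductive type whose constructors are $c_1,\dots,c_m$ in the listed order, $\varepsilon(c_i\,x_1\cdots x_a)=\lambda y_1\dots y_m.\,y_i\,\varepsilon(x_1)\cdots\varepsilon(x_a)$. In particular $\varepsilon(0)=\lambda zs.z$, $\varepsilon(S\,n)=\lambda zs.\,s\,\varepsilon(n)$; $\varepsilon(\mathsf{Some}\,x)=\lambda ab.\,a\,\varepsilon(x)$, $\varepsilon(\mathsf{None})=\lambda ab.\,b$; $\varepsilon((x,y))=\lambda a.\,a\,\varepsilon(x)\,\varepsilon(y)$; $\varepsilon(\mathsf{cst}\,n)=\lambda abcd.\,a\,\varepsilon(n)$, $\varepsilon(\mathsf{var}\,n)=\lambda abcd.\,b\,\varepsilon(n)$, $\varepsilon(\mathsf{add}\,p\,q)=\lambda abcd.\,c\,\varepsilon(p)\,\varepsilon(q)$, $\varepsilon(\mathsf{mul}\,p\,q)=\lambda abcd.\,d\,\varepsilon(p)\,\varepsilon(q)$.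 For a function $f:A\to B$ between encodable types, $f\sim t_f$ ("$t_f$ computes $f$") means $t_f$ is a procedure and for all $a:A$ there is $v$ with $t_f\,\varepsilon(a)\succ^* v$ and $v=\varepsilon(f\,a)$. A predicate $q:Z\to\mathrm{Prop}$ on an encodable type $Z$ is L-enumerable if there is $f:\mathbb{N}\to\mathsf{option}\,Z$ computed by some term such that $\forall z.\ q\,z\leftrightarrow\exists n.\ f\,n=\mathsf{Some}\,z$. -}

module Defs where

open import Data.Nat using (ℕ; zero; suc; _+_; _*_; _<_; _≥_)
open import Data.Nat using (_≟_)
open import Data.List using (List; []; _∷_)
open import Data.Maybe using (Maybe; just; nothing)
open import Data.Product using (Σ; ∃; _×_; _,_)
open import Relation.Nullary using (yes; no)
open import Relation.Binary.PropositionalEquality using (_≡_)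
open import Relation.Binary.Construct.Closure.ReflexiveTransitive using (Star)
open import Function.Bundles using (_⇔_)

-- The weak call-by-value λ-calculus L (de Bruijn indices)

data Term : Set where
  var : ℕ → Term
  app : Term → Term → Term
  lam : Term → Term

subst : Term → ℕ → Term → Term
subst (var n) k u with n ≟ k
... | yes _ = u
... | no _  = var n
subst (app s t) k u = app (subst s k u) (subst t k u)
subst (lam s)   k u = lam (subst s (suc k) u)

infix 4 _≻_ _≻*_
data _≻_ : Term → Term → Set where
  β    : ∀ {s t} → app (lam s) (lam t) ≻ subst s 0 (lam t)
  appL : ∀ {s s' t} → s ≻ s' → app s t ≻ app s' t
  appR : ∀ {s t t'} → t ≻ t' → app s t ≻ app s t'

_≻*_ : Term → Term → Set
_≻*_ = Star _≻_

data Bound : ℕ → Term → Set where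
  bvar : ∀ {k n} → n < k → Bound k (var n)
  bapp : ∀ {k s t} → Bound k s → Bound k t → Bound k (app s t)
  blam : ∀ {k s} → Bound (suc k) s → Bound k (lam s)

Closed : Term → Set
Closed = Bound 0

Procedure : Term → Set
Procedure t = Closed t × Σ Term (λ s → t ≡ lam s)

-- Scott encodings

encNat : ℕ → Term
encNat zero    = lam (lam (var 1))
encNat (suc n) = lam (lam (app (var 0) (encNat n)))

encOption : {A : Set} → (A → Term) → Maybe A → Term
encOption e (just x) = lam (lam (app (var 1) (e x)))
encOption e nothing  = lam (lam (var 0))

encPair : {A B : Set} → (A → Term) → (B → Term) → A × B → Term
encPair ea eb (x , y) = lam (app (app (var 0) (ea x)) (eb y))

data Poly : Set where
  cst : ℕ → Poly
  pvar : ℕ → Poly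
  add : Poly → Poly → Poly
  mul : Poly → Poly → Poly

encPoly : Poly → Term
encPoly (cst n)   = lam (lam (lam (lam (app (var 3) (encNat n)))))
encPoly (pvar n)  = lam (lam (lam (lam (app (var 2) (encNat n)))))
encPoly (add p q) = lam (lam (lam (lam (app (app (var 1) (encPoly p)) (encPoly q)))))
encPoly (mul p q) = lam (lam (lam (lam (app (app (var 0) (encPoly p)) (encPoly q)))))

nth : List ℕ → ℕ → ℕ
nth []       _       = 0
nth (x ∷ S)  zero    = x
nth (x ∷ S)  (suc n) = nth S n

eval : Poly → List ℕ → ℕ
eval (cst n)   S = n
eval (pvar n)  S = nth S n
eval (add p q) S = eval p S + eval q S
eval (mul p q) S = eval p S * eval q S

H10 : Poly × Poly → Set
H10 (p₁ , p₂) = ∃ λ (S : List ℕ) → eval p₁ S ≡ eval p₂ S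

Computes : {A B : Set} → (A → Term) → (B → Term) → (A → B) → Term → Set
Computes encA encB f t =
  Procedure t × (∀ a → Σ Term (λ v → (app t (encA a) ≻* v) × (v ≡ encB (f a))))

LEnumerable : {Z : Set} → (Z → Term) → (Z → Set) → Set
LEnumerable {Z} encZ q =
  Σ (ℕ → Maybe Z) λ f →
    Σ Term (λ t → Computes encNat (encOption encZ) f t) ×
    (∀ z → q z ⇔ (∃ λ n → f n ≡ just z))

module Submission where

-- The enumerator reads its argument n, through iterated Cantor unpairing, as a
-- quadruple (k , a , b , s): the numbers a and b are decoded with fuel k into
-- polynomials P and Q, the number s is read as a valuation of the variables,
-- and the output is  Some (P , Q)  when P and Q agree under that valuation and
-- None otherwise.

open import Defs
open import Data.Nat using (ℕ; zero; suc; _+_; _*_; _<_; _≤_; _≡ᵇ_; z≤n; s≤s; _≟_; compare; less; equal; greater)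
open import Data.Nat.Properties
  using (≤-trans; m≤n⇒m≤1+n; n≤1+n; n<1+n; <-irrefl; m≤m+n; m≤n+m; m+n≤o⇒m≤o; m+n≤o⇒n≤o;
         +-suc; +-identityʳ; ≡ᵇ⇒≡; ≡⇒≡ᵇ)
open import Data.List using (List; []; _∷_; applyUpTo)
open import Data.Maybe using (Maybe; just; nothing)
open import Data.Product using (Σ; ∃; _×_; _,_; proj₁; proj₂)
open import Data.Bool using (Bool; true; false; if_then_else_)
open import Data.Bool.Properties using (T-≡)
open import Data.Empty using (⊥-elim)
open import Relation.Nullary using (yes; no)
import Relation.Binary.PropositionalEquality as Eq
open Eq using (_≡_; _≢_; refl; sym; trans; cong; cong₂; module ≡-Reasoning)
open import Relation.Binary.Construct.Closure.ReflexiveTransitive using (ε; _◅_; _◅◅_; gmap)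
open import Function.Bundles using (mk⇔; Equivalence)

weaken-Bound : ∀ {j k s} → j ≤ k → Bound j s → Bound k s
weaken-Bound le (bvar lt)  = bvar (≤-trans lt le)
weaken-Bound le (bapp a b) = bapp (weaken-Bound le a) (weaken-Bound le b)
weaken-Bound le (blam a)   = blam (weaken-Bound (s≤s le) a)

subst-var-≢ : ∀ {n k} u → n ≢ k → subst (var n) k u ≡ var n
subst-var-≢ {n} {k} u n≢k with n ≟ k
... | yes n≡k = ⊥-elim (n≢k n≡k)
... | no _    = refl

subst-var-≡ : ∀ k u → subst (var k) k u ≡ u
subst-var-≡ k u with k ≟ k
... | yes _   = refl
... | no k≢k  = ⊥-elim (k≢k refl)

subst-Bound : ∀ {j s} → Bound j s → ∀ k u → j ≤ k → subst s k u ≡ s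
subst-Bound (bvar {n = n} lt) k u le = subst-var-≢ u (λ n≡k → <-irrefl n≡k (≤-trans lt le))
subst-Bound (bapp a b) k u le = cong₂ app (subst-Bound a k u le) (subst-Bound b k u le)
subst-Bound (blam a)   k u le = cong lam (subst-Bound a (suc k) u (s≤s le))

Value : Set
Value = Σ Term Procedure

⌜_⌝ : Value → Term
⌜ v ⌝ = proj₁ v

-- Environments are lists of values; out-of-range positions read as the
-- identity, so that every entry is closed.
envAt : List Value → ℕ → Term
envAt []      _       = lam (var 0)
envAt (v ∷ σ) zero    = ⌜ v ⌝
envAt (v ∷ σ) (suc n) = envAt σ n

envAt-Closed : ∀ σ n → Closed (envAt σ n)
envAt-Closed []      n       = blam (bvar (s≤s z≤n))
envAt-Closed (v ∷ σ) zero    = proj₁ (proj₂ v)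
envAt-Closed (v ∷ σ) (suc n) = envAt-Closed σ n

-- Under k binders an index n is either bound locally (n < k) or refers to
-- environment position n - k.
data Slot : Set where
  local entry : ℕ → Slot

shift : Slot → Slot
shift (local m) = local (suc m)
shift (entry m) = entry m

classify : ℕ → ℕ → Slot
classify zero    n       = entry n
classify (suc k) zero    = local zero
classify (suc k) (suc n) = shift (classify k n)

classify-local : ∀ {k n} → n < k → classify k n ≡ local n
classify-local {suc k} {zero}  _        = refl
classify-local {suc k} {suc n} (s≤s lt) = cong shift (classify-local lt)

classify-entry : ∀ k m → classify k (k + m) ≡ entry m
classify-entry zero    m = refl
classify-entry (suc k) m = cong shift (classify-entry k m)

classify-self : ∀ k → classify k k ≡ entry 0
classify-self k = trans (cong (classify k) (sym (+-identityʳ k))) (classify-entry k 0)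

classify-beyond : ∀ k m → classify k (suc (k + m)) ≡ entry (suc m)
classify-beyond k m = trans (cong (classify k) (sym (+-suc k m))) (classify-entry k (suc m))

slotTerm : List Value → Slot → Term
slotTerm σ (local m) = var m
slotTerm σ (entry m) = envAt σ m

instantiate : List Value → ℕ → Term → Term
instantiate σ k (var n)   = slotTerm σ (classify k n)
instantiate σ k (app s t) = app (instantiate σ k s) (instantiate σ k t)
instantiate σ k (lam s)   = lam (instantiate σ (suc k) s)

slotTerm-Bound : ∀ σ k n → Bound k (slotTerm σ (classify k n))
slotTerm-Bound σ zero    n       = envAt-Closed σ n
slotTerm-Bound σ (suc k) zero    = bvar (s≤s z≤n)
slotTerm-Bound σ (suc k) (suc n) = shift-Bound (classify k n) (slotTerm-Bound σ k n)
  where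
  shift-Bound : ∀ w → Bound k (slotTerm σ w) → Bound (suc k) (slotTerm σ (shift w))
  shift-Bound (local m) (bvar lt) = bvar (s≤s lt)
  shift-Bound (entry m) b         = weaken-Bound (n≤1+n k) b

instantiate-Bound : ∀ σ k t → Bound k (instantiate σ k t)
instantiate-Bound σ k (var n)   = slotTerm-Bound σ k n
instantiate-Bound σ k (app s t) = bapp (instantiate-Bound σ k s) (instantiate-Bound σ k t)
instantiate-Bound σ k (lam s)   = blam (instantiate-Bound σ (suc k) s)

substSlot : List Value → Value → ℕ → Slot → Term
substSlot σ v k w = subst (slotTerm σ w) k ⌜ v ⌝

subst-slot : ∀ σ k n v → subst (slotTerm σ (classify (suc k) n)) k ⌜ v ⌝ ≡ slotTerm (v ∷ σ) (classify k n)
subst-slot σ k n v with compare n k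
... | less .n m = begin
  subst (slotTerm σ (classify (suc k) n)) k ⌜ v ⌝ ≡⟨ cong (substSlot σ v k) (classify-local (m≤n⇒m≤1+n n<k)) ⟩
  subst (var n) k ⌜ v ⌝                            ≡⟨ subst-var-≢ ⌜ v ⌝ (λ n≡k → <-irrefl n≡k n<k) ⟩
  var n                                            ≡⟨ cong (slotTerm (v ∷ σ)) (classify-local n<k) ⟨
  slotTerm (v ∷ σ) (classify k n)                  ∎
  where open ≡-Reasoning
        n<k : n < suc (n + m)
        n<k = s≤s (m≤m+n n m)
... | equal .n = begin
  subst (slotTerm σ (classify (suc n) n)) n ⌜ v ⌝ ≡⟨ cong (substSlot σ v n) (classify-local (n<1+n n)) ⟩
  subst (var n) n ⌜ v ⌝                            ≡⟨ subst-var-≡ n ⌜ v ⌝ ⟩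
  ⌜ v ⌝                                            ≡⟨ cong (slotTerm (v ∷ σ)) (classify-self n) ⟨
  slotTerm (v ∷ σ) (classify n n)                  ∎
  where open ≡-Reasoning
... | greater .k m = begin
  subst (slotTerm σ (shift (classify k (k + m)))) k ⌜ v ⌝
    ≡⟨ cong (λ w → substSlot σ v k (shift w)) (classify-entry k m) ⟩
  subst (envAt σ m) k ⌜ v ⌝                    ≡⟨ subst-Bound (envAt-Closed σ m) k ⌜ v ⌝ z≤n ⟩
  envAt σ m                                    ≡⟨ cong (slotTerm (v ∷ σ)) (classify-beyond k m) ⟨
  slotTerm (v ∷ σ) (classify k (suc (k + m))) ∎
  where open ≡-Reasoning

instantiate-subst : ∀ σ k t v → subst (instantiate σ (suc k) t) k ⌜ v ⌝ ≡ instantiate (v ∷ σ) k t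
instantiate-subst σ k (var n)   v = subst-slot σ k n v
instantiate-subst σ k (app s t) v = cong₂ app (instantiate-subst σ k s v) (instantiate-subst σ k t v)
instantiate-subst σ k (lam s)   v = cong lam (instantiate-subst σ (suc k) s v)

closure : List Value → Term → Value
closure σ b = instantiate σ 0 (lam b) , instantiate-Bound σ 0 (lam b) , instantiate σ 1 b , refl

appL* : ∀ {s s' t} → s ≻* s' → app s t ≻* app s' t
appL* {t = t} = gmap (λ s → app s t) appL

appR* : ∀ {s t t'} → t ≻* t' → app s t ≻* app s t'
appR* {s = s} = gmap (app s) appR

β-closure : ∀ σ b (v : Value) → app ⌜ closure σ b ⌝ ⌜ v ⌝ ≻* instantiate (v ∷ σ) 0 b
β-closure σ b (w , c , t , refl) =
  Eq.subst (app (lam (instantiate σ 1 b)) (lam t) ≻*_) (instantiate-subst σ 0 b (lam t , c , t , refl)) (β ◅ ε)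

β-closure₂ : ∀ σ b (v w : Value) → app (app ⌜ closure σ (lam b) ⌝ ⌜ v ⌝) ⌜ w ⌝ ≻* instantiate (w ∷ v ∷ σ) 0 b
β-closure₂ σ b v w = appL* (β-closure σ (lam b) v) ◅◅ β-closure (v ∷ σ) b w

β-closure₃ : ∀ σ b (v w x : Value) →
  app (app (app ⌜ closure σ (lam (lam b)) ⌝ ⌜ v ⌝) ⌜ w ⌝) ⌜ x ⌝ ≻* instantiate (x ∷ w ∷ v ∷ σ) 0 b
β-closure₃ σ b v w x = appL* (β-closure₂ σ (lam b) v w) ◅◅ β-closure (w ∷ v ∷ σ) b x

β-closure₄ : ∀ σ b (v w x y : Value) →
  app (app (app (app ⌜ closure σ (lam (lam (lam b))) ⌝ ⌜ v ⌝) ⌜ w ⌝) ⌜ x ⌝) ⌜ y ⌝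
  ≻* instantiate (y ∷ x ∷ w ∷ v ∷ σ) 0 b
β-closure₄ σ b v w x y = appL* (β-closure₃ σ (lam b) v w x) ◅◅ β-closure (x ∷ w ∷ v ∷ σ) b y

closed : ∀ {k s} → Closed s → Bound k s
closed = weaken-Bound z≤n

encNat-Closed : ∀ n → Closed (encNat n)
encNat-Closed zero    = blam (blam (bvar (s≤s (s≤s z≤n))))
encNat-Closed (suc n) = blam (blam (bapp (bvar (s≤s z≤n)) (closed (encNat-Closed n))))

encNat-Procedure : ∀ n → Procedure (encNat n)
encNat-Procedure zero    = encNat-Closed zero , _ , refl
encNat-Procedure (suc n) = encNat-Closed (suc n) , _ , refl

natV : ℕ → Value
natV n = encNat n , encNat-Procedure n

encPoly-Closed : ∀ p → Closed (encPoly p)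
encPoly-Closed (cst n)   = blam (blam (blam (blam (bapp (bvar (s≤s (s≤s (s≤s (s≤s z≤n))))) (closed (encNat-Closed n))))))
encPoly-Closed (pvar n)  = blam (blam (blam (blam (bapp (bvar (s≤s (s≤s (s≤s z≤n)))) (closed (encNat-Closed n))))))
encPoly-Closed (add p q) = blam (blam (blam (blam (bapp (bapp (bvar (s≤s (s≤s z≤n))) (closed (encPoly-Closed p))) (closed (encPoly-Closed q))))))
encPoly-Closed (mul p q) = blam (blam (blam (blam (bapp (bapp (bvar (s≤s z≤n)) (closed (encPoly-Closed p))) (closed (encPoly-Closed q))))))

encPoly-Procedure : ∀ p → Procedure (encPoly p)
encPoly-Procedure (cst n)   = encPoly-Closed (cst n) , _ , refl
encPoly-Procedure (pvar n)  = encPoly-Closed (pvar n) , _ , refl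
encPoly-Procedure (add p q) = encPoly-Closed (add p q) , _ , refl
encPoly-Procedure (mul p q) = encPoly-Closed (mul p q) , _ , refl

polyV : Poly → Value
polyV p = encPoly p , encPoly-Procedure p

-- The Scott pair  λf. f x y  (its term is  encPair encNat encNat (x , y)).
pairV : ℕ × ℕ → Value
pairV (x , y) = closure (natV y ∷ natV x ∷ []) (app (app (var 0) (var 2)) (var 1))

caseNat-zero : ∀ (z s : Value) → app (app (encNat 0) ⌜ z ⌝) ⌜ s ⌝ ≻* ⌜ z ⌝
caseNat-zero = β-closure₂ [] (var 1)

caseNat-suc : ∀ k (z s : Value) → app (app (encNat (suc k)) ⌜ z ⌝) ⌜ s ⌝ ≻* app ⌜ s ⌝ (encNat k)
caseNat-suc k = β-closure₂ (natV k ∷ []) (app (var 0) (var 2))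

casePair : ∀ x y (f : Value) → app ⌜ pairV (x , y) ⌝ ⌜ f ⌝ ≻* app (app ⌜ f ⌝ (encNat x)) (encNat y)
casePair x y = β-closure (natV y ∷ natV x ∷ []) (app (app (var 0) (var 2)) (var 1))

cases : Poly → (a b c d : Value) → Term
cases p a b c d = app (app (app (app (encPoly p) ⌜ a ⌝) ⌜ b ⌝) ⌜ c ⌝) ⌜ d ⌝

casePoly-cst : ∀ n a b c d → cases (cst n) a b c d ≻* app ⌜ a ⌝ (encNat n)
casePoly-cst n = β-closure₄ (natV n ∷ []) (app (var 3) (var 4))

casePoly-var : ∀ n a b c d → cases (pvar n) a b c d ≻* app ⌜ b ⌝ (encNat n)
casePoly-var n = β-closure₄ (natV n ∷ []) (app (var 2) (var 4))

casePoly-add : ∀ p q a b c d → cases (add p q) a b c d ≻* app (app ⌜ c ⌝ (encPoly p)) (encPoly q)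
casePoly-add p q = β-closure₄ (polyV q ∷ polyV p ∷ []) (app (app (var 1) (var 5)) (var 4))

casePoly-mul : ∀ p q a b c d → cases (mul p q) a b c d ≻* app (app ⌜ d ⌝ (encPoly p)) (encPoly q)
casePoly-mul p q = β-closure₄ (polyV q ∷ polyV p ∷ []) (app (app (var 0) (var 5)) (var 4))

trueT falseT : Term
trueT  = lam (lam (var 1))
falseT = lam (lam (var 0))

boolV : Bool → Value
boolV true  = closure [] (lam (var 1))
boolV false = closure [] (lam (var 0))

select : ∀ b (x y : Value) → app (app ⌜ boolV b ⌝ ⌜ x ⌝) ⌜ y ⌝ ≻* ⌜ (if b then x else y) ⌝
select true  = β-closure₂ [] (var 1)
select false = β-closure₂ [] (var 0)

-- Recursion: for a functional F,  fix F = λv. A A v  with  A = λx. F (λv. x x v),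
-- so that  fix F v  unfolds to  F (fix F) v  on every value v.
selfApplicator : Value → Value
selfApplicator F = closure (F ∷ []) (app (var 1) (lam (app (app (var 1) (var 1)) (var 0))))

fix : Value → Value
fix F = closure (selfApplicator F ∷ []) (app (app (var 1) (var 1)) (var 0))

fix-unfold : ∀ F v → app ⌜ fix F ⌝ ⌜ v ⌝ ≻* app (app ⌜ F ⌝ ⌜ fix F ⌝) ⌜ v ⌝
fix-unfold F v = β-closure (selfApplicator F ∷ []) (app (app (var 1) (var 1)) (var 0)) v
  ◅◅ appL* (β-closure (F ∷ []) (app (var 1) (lam (app (app (var 1) (var 1)) (var 0)))) (selfApplicator F))

-- The L-programs below are closure bodies in de Bruijn notation; the comment
-- above each gives the program with named variables.

-- succ = λ j z s. s j
succV : Value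
succV = closure [] (lam (lam (app (var 0) (var 2))))

succ-computes : ∀ j → app ⌜ succV ⌝ (encNat j) ≻* encNat (suc j)
succ-computes j = β-closure [] (lam (lam (app (var 0) (var 2)))) (natV j)

-- add = fix (λ rec n m. n m (λ k. succ (rec k m)))
addStep addBody : Term
addStep = app (var 4) (app (app (var 3) (var 0)) (var 1))
addBody = app (app (var 1) (var 0)) (lam addStep)

addF addV : Value
addF = closure (succV ∷ []) (lam (lam addBody))
addV = fix addF

add-computes : ∀ n m → app (app ⌜ addV ⌝ (encNat n)) (encNat m) ≻* encNat (n + m)
add-computes zero m = appL* (fix-unfold addF (natV 0)) ◅◅ β-closure₃ (succV ∷ []) addBody addV (natV 0) (natV m)
  ◅◅ caseNat-zero (natV m) (closure (natV m ∷ natV 0 ∷ addV ∷ succV ∷ []) addStep)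
add-computes (suc k) m = appL* (fix-unfold addF (natV (suc k))) ◅◅ β-closure₃ (succV ∷ []) addBody addV (natV (suc k)) (natV m)
  ◅◅ caseNat-suc k (natV m) (closure σ addStep) ◅◅ β-closure σ addStep (natV k)
  ◅◅ appR* (add-computes k m) ◅◅ succ-computes (k + m)
  where σ = natV m ∷ natV (suc k) ∷ addV ∷ succV ∷ []

-- mul = fix (λ rec n m. n 0 (λ k. add m (rec k m)))
mulStep mulBody : Term
mulStep = app (app (var 4) (var 1)) (app (app (var 3) (var 0)) (var 1))
mulBody = app (app (var 1) (encNat 0)) (lam mulStep)

mulF mulV : Value
mulF = closure (addV ∷ []) (lam (lam mulBody))
mulV = fix mulF

mul-computes : ∀ n m → app (app ⌜ mulV ⌝ (encNat n)) (encNat m) ≻* encNat (n * m)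
mul-computes zero m = appL* (fix-unfold mulF (natV 0)) ◅◅ β-closure₃ (addV ∷ []) mulBody mulV (natV 0) (natV m)
  ◅◅ caseNat-zero (natV 0) (closure (natV m ∷ natV 0 ∷ mulV ∷ addV ∷ []) mulStep)
mul-computes (suc k) m = appL* (fix-unfold mulF (natV (suc k))) ◅◅ β-closure₃ (addV ∷ []) mulBody mulV (natV (suc k)) (natV m)
  ◅◅ caseNat-suc k (natV 0) (closure σ mulStep) ◅◅ β-closure σ mulStep (natV k)
  ◅◅ appR* (mul-computes k m) ◅◅ add-computes m (k * m)
  where σ = natV m ∷ natV (suc k) ∷ mulV ∷ addV ∷ []

-- iszero = λ m. m true (λ _. false)
-- eq     = fix (λ rec n m. n iszero (λ k m'. m' false (λ j. rec k j)) m)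
isZeroBody eqRec eqSuc eqBody : Term
isZeroBody = app (app (var 0) trueT) (lam falseT)
eqRec      = app (app (var 5) (var 2)) (var 0)
eqSuc      = lam (app (app (var 0) falseT) (lam eqRec))
eqBody     = app (app (app (var 1) (lam isZeroBody)) (lam eqSuc)) (var 0)

isZeroV : Value
isZeroV = closure [] isZeroBody

eqF eqV : Value
eqF = closure [] (lam (lam eqBody))
eqV = fix eqF

isZero-computes : ∀ m → app ⌜ isZeroV ⌝ (encNat m) ≻* ⌜ boolV (zero ≡ᵇ m) ⌝
isZero-computes m = β-closure [] isZeroBody (natV m) ◅◅ byCase m
  where
  byCase : ∀ m → app (app (encNat m) trueT) (lam falseT) ≻* ⌜ boolV (zero ≡ᵇ m) ⌝
  byCase zero    = caseNat-zero (boolV true) (closure [] falseT)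
  byCase (suc j) = caseNat-suc j (boolV true) (closure [] falseT) ◅◅ β-closure [] falseT (natV j)

eq-computes : ∀ n m → app (app ⌜ eqV ⌝ (encNat n)) (encNat m) ≻* ⌜ boolV (n ≡ᵇ m) ⌝
eq-computes zero m = appL* (fix-unfold eqF (natV 0)) ◅◅ β-closure₃ [] eqBody eqV (natV 0) (natV m)
  ◅◅ appL* (caseNat-zero isZeroV (closure (natV m ∷ natV 0 ∷ eqV ∷ []) eqSuc)) ◅◅ isZero-computes m
eq-computes (suc k) m = appL* (fix-unfold eqF (natV (suc k))) ◅◅ β-closure₃ [] eqBody eqV (natV (suc k)) (natV m)
  ◅◅ appL* (caseNat-suc k isZeroV (closure σ eqSuc)) ◅◅ β-closure₂ σ (app (app (var 0) falseT) (lam eqRec)) (natV k) (natV m)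
  ◅◅ byCase m
  where
  σ = natV m ∷ natV (suc k) ∷ eqV ∷ []
  byCase : ∀ m' → app (app (encNat m') falseT) ⌜ closure (natV m' ∷ natV k ∷ σ) eqRec ⌝ ≻* ⌜ boolV (suc k ≡ᵇ m') ⌝
  byCase zero    = caseNat-zero (boolV false) (closure (natV zero ∷ natV k ∷ σ) eqRec)
  byCase (suc j) = caseNat-suc j (boolV false) (closure (natV (suc j) ∷ natV k ∷ σ) eqRec)
    ◅◅ β-closure (natV (suc j) ∷ natV k ∷ σ) eqRec (natV j) ◅◅ eq-computes k j

-- Cantor unpairing: unpair enumerates ℕ × ℕ along the anti-diagonals,
-- step moving from (x , y) to the next pair.
step : ℕ × ℕ → ℕ × ℕ
step (x , zero)  = 0 , suc x
step (x , suc y) = suc x , y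

unpair : ℕ → ℕ × ℕ
unpair zero    = 0 , 0
unpair (suc n) = step (unpair n)

-- step = λ p. p (λ x y. y (pair 0 (succ x)) (λ y'. pair (succ x) y'))
stepDiag stepInner stepPair stepBody : Term
stepDiag  = app (app (var 0) (encNat 0)) (lam (lam (app (var 0) (var 4))))
stepInner = lam (app (app (var 0) (lam (lam (app (var 0) (var 5))))) (var 1))
stepPair  = app (app (var 0) (lam stepDiag)) (lam stepInner)
stepBody  = app (var 0) (lam (lam stepPair))

stepV : Value
stepV = closure [] stepBody

step-computes : ∀ x y → app ⌜ stepV ⌝ ⌜ pairV (x , y) ⌝ ≻* ⌜ pairV (step (x , y)) ⌝
step-computes x y = β-closure [] stepBody (pairV (x , y))
  ◅◅ casePair x y (closure (pairV (x , y) ∷ []) (lam stepPair))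
  ◅◅ β-closure₂ (pairV (x , y) ∷ []) stepPair (natV x) (natV y) ◅◅ byCase y
  where
  frame : ℕ → List Value
  frame y' = natV y' ∷ natV x ∷ pairV (x , y) ∷ []
  byCase : ∀ y' → app (app (encNat y') ⌜ closure (frame y') stepDiag ⌝) ⌜ closure (frame y') stepInner ⌝
                  ≻* ⌜ pairV (step (x , y')) ⌝
  byCase zero    = caseNat-zero (closure (frame zero) stepDiag) (closure (frame zero) stepInner)
  byCase (suc j) = caseNat-suc j (closure (frame (suc j)) stepDiag) (closure (frame (suc j)) stepInner)
    ◅◅ β-closure (frame (suc j)) stepInner (natV j)

-- unpair = fix (λ rec n. n (pair 0 0) (λ k. step (rec k)))
unpairStep unpairBody : Term
unpairStep = app (var 3) (app (var 2) (var 0))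
unpairBody = app (app (var 0) (encPair encNat encNat (0 , 0))) (lam unpairStep)

unpairF unpairV : Value
unpairF = closure (stepV ∷ []) (lam unpairBody)
unpairV = fix unpairF

unpair-computes : ∀ n → app ⌜ unpairV ⌝ (encNat n) ≻* ⌜ pairV (unpair n) ⌝
unpair-computes zero = fix-unfold unpairF (natV 0) ◅◅ β-closure₂ (stepV ∷ []) unpairBody unpairV (natV 0)
  ◅◅ caseNat-zero (pairV (0 , 0)) (closure (natV 0 ∷ unpairV ∷ stepV ∷ []) unpairStep)
unpair-computes (suc k) = fix-unfold unpairF (natV (suc k)) ◅◅ β-closure₂ (stepV ∷ []) unpairBody unpairV (natV (suc k))
  ◅◅ caseNat-suc k (pairV (0 , 0)) (closure σ unpairStep) ◅◅ β-closure σ unpairStep (natV k)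
  ◅◅ appR* (unpair-computes k) ◅◅ step-computes (proj₁ (unpair k)) (proj₂ (unpair k))
  where σ = natV (suc k) ∷ unpairV ∷ stepV ∷ []

mutual
  valuation : ℕ → ℕ → ℕ
  valuation s i = valuationOf (unpair s) i

  valuationOf : ℕ × ℕ → ℕ → ℕ
  valuationOf (h , tl) zero    = h
  valuationOf (h , tl) (suc i) = valuation tl i

-- valuation = fix (λ rec s i. unpair s (λ h tl. i h (λ j. rec tl j)))
valRec valCase valBody : Term
valRec  = app (app (var 5) (var 1)) (var 0)
valCase = app (app (var 2) (var 1)) (lam valRec)
valBody = app (app (var 3) (var 1)) (lam (lam valCase))

valuationF valuationV : Value
valuationF = closure (unpairV ∷ []) (lam (lam valBody))
valuationV = fix valuationF

valuationAt : ℕ → Value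
valuationAt s = closure (natV s ∷ valuationV ∷ unpairV ∷ []) valBody

valuation-partial : ∀ s → app ⌜ valuationV ⌝ (encNat s) ≻* ⌜ valuationAt s ⌝
valuation-partial s = fix-unfold valuationF (natV s) ◅◅ β-closure₂ (unpairV ∷ []) (lam valBody) valuationV (natV s)

mutual
  valuation-computes : ∀ s i → app ⌜ valuationAt s ⌝ (encNat i) ≻* encNat (valuation s i)
  valuation-computes s i = β-closure (natV s ∷ valuationV ∷ unpairV ∷ []) valBody (natV i)
    ◅◅ appL* (unpair-computes s) ◅◅ valuationOf-computes s i (unpair s)

  valuationOf-computes : ∀ s i pr →
    app ⌜ pairV pr ⌝ ⌜ closure (natV i ∷ natV s ∷ valuationV ∷ unpairV ∷ []) (lam valCase) ⌝ ≻* encNat (valuationOf pr i)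
  valuationOf-computes s zero (h , tl) = casePair h tl (closure σ (lam valCase)) ◅◅ β-closure₂ σ valCase (natV h) (natV tl)
    ◅◅ caseNat-zero (natV h) (closure (natV tl ∷ natV h ∷ σ) valRec)
    where σ = natV zero ∷ natV s ∷ valuationV ∷ unpairV ∷ []
  valuationOf-computes s (suc j) (h , tl) = casePair h tl (closure σ (lam valCase)) ◅◅ β-closure₂ σ valCase (natV h) (natV tl)
    ◅◅ caseNat-suc j (natV h) (closure (natV tl ∷ natV h ∷ σ) valRec) ◅◅ β-closure (natV tl ∷ natV h ∷ σ) valRec (natV j)
    ◅◅ appL* (valuation-partial tl) ◅◅ valuation-computes tl j
    where σ = natV (suc j) ∷ natV s ∷ valuationV ∷ unpairV ∷ []

evalWith : Poly → (ℕ → ℕ) → ℕ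
evalWith (cst n)   g = n
evalWith (pvar n)  g = g n
evalWith (add p q) g = evalWith p g + evalWith q g
evalWith (mul p q) g = evalWith p g * evalWith q g

-- eval = fix (λ rec p e. p (λ n. n) (λ n. e n)
--                          (λ p q. add (rec p e) (rec q e)) (λ p q. mul (rec p e) (rec q e)))
evalAdd evalMul evalBody : Term
evalAdd  = app (app (var 5) (app (app (var 4) (var 1)) (var 2))) (app (app (var 4) (var 0)) (var 2))
evalMul  = app (app (var 6) (app (app (var 4) (var 1)) (var 2))) (app (app (var 4) (var 0)) (var 2))
evalBody = app (app (app (app (var 1) (lam (var 0))) (lam (app (var 1) (var 0)))) (lam (lam evalAdd))) (lam (lam evalMul))

evalF evalV : Value
evalF = closure (addV ∷ mulV ∷ []) (lam (lam evalBody))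
evalV = fix evalF

evalFrame : Value → Poly → List Value
evalFrame e p = e ∷ polyV p ∷ evalV ∷ addV ∷ mulV ∷ []

cstBranch varBranch addBranch mulBranch : Value → Poly → Value
cstBranch e p = closure (evalFrame e p) (var 0)
varBranch e p = closure (evalFrame e p) (app (var 1) (var 0))
addBranch e p = closure (evalFrame e p) (lam evalAdd)
mulBranch e p = closure (evalFrame e p) (lam evalMul)

eval-dispatch : ∀ p e → app (app ⌜ evalV ⌝ (encPoly p)) ⌜ e ⌝ ≻*
  cases p (cstBranch e p) (varBranch e p) (addBranch e p) (mulBranch e p)
eval-dispatch p e = appL* (fix-unfold evalF (polyV p)) ◅◅ β-closure₃ (addV ∷ mulV ∷ []) evalBody evalV (polyV p) e

eval-computes : ∀ p (e : Value) (g : ℕ → ℕ) → (∀ i → app ⌜ e ⌝ (encNat i) ≻* encNat (g i)) →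
  app (app ⌜ evalV ⌝ (encPoly p)) ⌜ e ⌝ ≻* encNat (evalWith p g)
eval-computes (cst n) e g e∼g = eval-dispatch node e
  ◅◅ casePoly-cst n (cstBranch e node) (varBranch e node) (addBranch e node) (mulBranch e node)
  ◅◅ β-closure (evalFrame e node) (var 0) (natV n)
  where node = cst n
eval-computes (pvar n) e g e∼g = eval-dispatch node e
  ◅◅ casePoly-var n (cstBranch e node) (varBranch e node) (addBranch e node) (mulBranch e node)
  ◅◅ β-closure (evalFrame e node) (app (var 1) (var 0)) (natV n) ◅◅ e∼g n
  where node = pvar n
eval-computes (add p q) e g e∼g = eval-dispatch node e
  ◅◅ casePoly-add p q (cstBranch e node) (varBranch e node) (addBranch e node) (mulBranch e node)
  ◅◅ β-closure₂ (evalFrame e node) evalAdd (polyV p) (polyV q)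
  ◅◅ appL* (appR* (eval-computes p e g e∼g)) ◅◅ appR* (eval-computes q e g e∼g) ◅◅ add-computes _ _
  where node = add p q
eval-computes (mul p q) e g e∼g = eval-dispatch node e
  ◅◅ casePoly-mul p q (cstBranch e node) (varBranch e node) (addBranch e node) (mulBranch e node)
  ◅◅ β-closure₂ (evalFrame e node) evalMul (polyV p) (polyV q)
  ◅◅ appL* (appR* (eval-computes p e g e∼g)) ◅◅ appR* (eval-computes q e g e∼g) ◅◅ mul-computes _ _
  where node = mul p q

binary : ℕ → Poly → Poly → Poly
binary zero    p q = add p q
binary (suc _) p q = mul p q

mutual
  decode : ℕ → ℕ → Poly
  decode zero    m = cst 0
  decode (suc k) m = decodeNode k (unpair m)

  decodeNode : ℕ → ℕ × ℕ → Poly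
  decodeNode k (zero , r)        = cst r
  decodeNode k (suc zero , r)    = pvar r
  decodeNode k (suc (suc t) , r) = decodeBinary k t (unpair r)

  decodeBinary : ℕ → ℕ → ℕ × ℕ → Poly
  decodeBinary k t (a , b) = binary t (decode k a) (decode k b)

-- decode = fix (λ rec k m. k (cst 0) (λ k'. unpair m (λ t r.
--            t (cst r) (λ t₁. t₁ (var r) (λ t₂. unpair r (λ a b.
--              (λ P Q. t₂ (add P Q) (λ _. mul P Q)) (rec k' a) (rec k' b)))))))
mkCst mkVar mkAdd mkMul : Term
mkCst    = lam (lam (lam (lam (app (var 3) (var 4)))))
mkVar    = lam (lam (lam (lam (app (var 2) (var 5)))))
mkAdd    = lam (lam (lam (lam (app (app (var 1) (var 5)) (var 4)))))
mkMul    = lam (lam (lam (lam (app (app (var 0) (var 6)) (var 5)))))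

decOp decChildren decTag₂ decTag₁ decTag decSuc decBody : Term
decOp       = app (app (var 4) mkAdd) (lam mkMul)
decChildren = app (app (lam (lam decOp)) (app (app (var 9) (var 6)) (var 1))) (app (app (var 9) (var 6)) (var 0))
decTag₂     = app (app (var 8) (var 2)) (lam (lam decChildren))
decTag₁     = app (app (var 0) mkVar) (lam decTag₂)
decTag      = app (app (var 1) mkCst) (lam decTag₁)
decSuc      = app (app (var 4) (var 1)) (lam (lam decTag))
decBody     = app (app (var 1) (encPoly (cst 0))) (lam decSuc)

decodeF decodeV : Value
decodeF = closure (unpairV ∷ []) (lam (lam decBody))
decodeV = fix decodeF

nodeFrame : ℕ → ℕ → List Value
nodeFrame k m = natV k ∷ natV m ∷ natV (suc k) ∷ decodeV ∷ unpairV ∷ []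

childrenFrame : ℕ → ℕ → ℕ → ℕ → List Value
childrenFrame k m r t = natV t ∷ natV (suc t) ∷ natV r ∷ natV (suc (suc t)) ∷ nodeFrame k m

mutual
  decode-computes : ∀ k m → app (app ⌜ decodeV ⌝ (encNat k)) (encNat m) ≻* encPoly (decode k m)
  decode-computes zero m = appL* (fix-unfold decodeF (natV 0))
    ◅◅ β-closure₃ (unpairV ∷ []) decBody decodeV (natV 0) (natV m)
    ◅◅ caseNat-zero (polyV (cst 0)) (closure (natV m ∷ natV 0 ∷ decodeV ∷ unpairV ∷ []) decSuc)
  decode-computes (suc k) m = appL* (fix-unfold decodeF (natV (suc k)))
    ◅◅ β-closure₃ (unpairV ∷ []) decBody decodeV (natV (suc k)) (natV m)
    ◅◅ caseNat-suc k (polyV (cst 0)) (closure σ decSuc) ◅◅ β-closure σ decSuc (natV k)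
    ◅◅ appL* (unpair-computes m) ◅◅ decodeNode-computes k m (unpair m)
    where σ = natV m ∷ natV (suc k) ∷ decodeV ∷ unpairV ∷ []

  decodeNode-computes : ∀ k m pr →
    app ⌜ pairV pr ⌝ ⌜ closure (nodeFrame k m) (lam decTag) ⌝ ≻* encPoly (decodeNode k pr)
  decodeNode-computes k m (zero , r) = casePair 0 r (closure σ (lam decTag)) ◅◅ β-closure₂ σ decTag (natV 0) (natV r)
    ◅◅ caseNat-zero (polyV (cst r)) (closure (natV r ∷ natV 0 ∷ σ) decTag₁)
    where σ = nodeFrame k m
  decodeNode-computes k m (suc zero , r) = casePair 1 r (closure σ (lam decTag)) ◅◅ β-closure₂ σ decTag (natV 1) (natV r)
    ◅◅ caseNat-suc 0 (polyV (cst r)) (closure σ₁ decTag₁) ◅◅ β-closure σ₁ decTag₁ (natV 0)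
    ◅◅ caseNat-zero (polyV (pvar r)) (closure (natV 0 ∷ σ₁) decTag₂)
    where σ  = nodeFrame k m
          σ₁ = natV r ∷ natV 1 ∷ σ
  decodeNode-computes k m (suc (suc t) , r) = casePair (suc (suc t)) r (closure σ (lam decTag))
    ◅◅ β-closure₂ σ decTag (natV (suc (suc t))) (natV r)
    ◅◅ caseNat-suc (suc t) (polyV (cst r)) (closure σ₁ decTag₁) ◅◅ β-closure σ₁ decTag₁ (natV (suc t))
    ◅◅ caseNat-suc t (polyV (pvar r)) (closure σ₂ decTag₂) ◅◅ β-closure σ₂ decTag₂ (natV t)
    ◅◅ appL* (unpair-computes r) ◅◅ decodeBinary-computes k m r t (unpair r)
    where σ  = nodeFrame k m
          σ₁ = natV r ∷ natV (suc (suc t)) ∷ σ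
          σ₂ = natV (suc t) ∷ σ₁

  decodeBinary-computes : ∀ k m r t pr →
    app ⌜ pairV pr ⌝ ⌜ closure (childrenFrame k m r t) (lam decChildren) ⌝ ≻* encPoly (decodeBinary k t pr)
  decodeBinary-computes k m r t (a , b) = casePair a b (closure σ (lam decChildren))
    ◅◅ β-closure₂ σ decChildren (natV a) (natV b)
    ◅◅ appL* (appR* (decode-computes k a)) ◅◅ appR* (decode-computes k b)
    ◅◅ β-closure₂ σ₁ decOp (polyV (decode k a)) (polyV (decode k b)) ◅◅ combine t
    where
    σ  = childrenFrame k m r t
    σ₁ = natV b ∷ natV a ∷ σ
    σ₂ = polyV (decode k b) ∷ polyV (decode k a) ∷ σ₁
    combine : ∀ t' → app (app (encNat t') (encPoly (add (decode k a) (decode k b)))) ⌜ closure σ₂ mkMul ⌝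
                     ≻* encPoly (binary t' (decode k a) (decode k b))
    combine zero     = caseNat-zero (polyV (add (decode k a) (decode k b))) (closure σ₂ mkMul)
    combine (suc t') = caseNat-suc t' (polyV (add (decode k a) (decode k b))) (closure σ₂ mkMul)
      ◅◅ β-closure σ₂ mkMul (natV t')

check : Poly → Poly → ℕ → Maybe (Poly × Poly)
check P Q s = if evalWith P (valuation s) ≡ᵇ evalWith Q (valuation s) then just (P , Q) else nothing

enumerate₃ : ℕ → ℕ → ℕ × ℕ → Maybe (Poly × Poly)
enumerate₃ k a bs = check (decode k a) (decode k (proj₁ bs)) (proj₂ bs)

enumerate₂ : ℕ → ℕ × ℕ → Maybe (Poly × Poly)
enumerate₂ k ar = enumerate₃ k (proj₁ ar) (unpair (proj₂ ar))

enumerate₁ : ℕ × ℕ → Maybe (Poly × Poly)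
enumerate₁ kr = enumerate₂ (proj₁ kr) (unpair (proj₂ kr))

enumerate : ℕ → Maybe (Poly × Poly)
enumerate n = enumerate₁ (unpair n)

encResult : Maybe (Poly × Poly) → Term
encResult = encOption (encPair encPoly encPoly)

-- enumerate = λ n. unpair n (λ k r. unpair r (λ a r'. unpair r' (λ b s.
--               (λ P Q. (λ e. eq (eval P e) (eval Q e) (Some (P , Q)) None) (valuation s))
--               (decode k a) (decode k b))))
someT noneT testBody withValuation withPolys readB readA enumBody : Term
someT         = lam (app (var 1) (lam (app (app (var 0) (var 5)) (var 4))))
noneT         = lam (lam (var 0))
testBody      = app (app (app (app (var 14) (app (app (var 13) (var 2)) (var 0))) (app (app (var 13) (var 1)) (var 0))) (lam someT)) noneT
withValuation = app (lam testBody) (app (var 11) (var 2))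
withPolys     = app (app (lam (lam withValuation)) (app (app (var 8) (var 5)) (var 3))) (app (app (var 8) (var 5)) (var 1))
readB         = app (app (var 5) (var 0)) (lam (lam withPolys))
readA         = app (app (var 3) (var 0)) (lam (lam readB))
enumBody      = app (app (var 1) (var 0)) (lam (lam readA))

library : List Value
library = unpairV ∷ decodeV ∷ valuationV ∷ evalV ∷ eqV ∷ []

enumerateV : Value
enumerateV = closure library enumBody

enumerate₃-computes : ∀ n k r a r' bs →
  app ⌜ pairV bs ⌝ ⌜ closure (natV r' ∷ natV a ∷ natV r ∷ natV k ∷ natV n ∷ library) (lam withPolys) ⌝
  ≻* encResult (enumerate₃ k a bs)
enumerate₃-computes n k r a r' (b , s) = casePair b s (closure σ (lam withPolys)) ◅◅ β-closure₂ σ withPolys (natV b) (natV s)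
  ◅◅ appL* (appR* (decode-computes k a)) ◅◅ appR* (decode-computes k b) ◅◅ β-closure₂ σ₁ withValuation (polyV P) (polyV Q)
  ◅◅ appR* (valuation-partial s) ◅◅ β-closure σ₂ testBody (valuationAt s)
  ◅◅ appL* (appL* (appL* (appR* (eval-computes P (valuationAt s) (valuation s) (valuation-computes s)))))
  ◅◅ appL* (appL* (appR* (eval-computes Q (valuationAt s) (valuation s) (valuation-computes s))))
  ◅◅ appL* (appL* (eq-computes (evalWith P (valuation s)) (evalWith Q (valuation s))))
  ◅◅ selectResult (evalWith P (valuation s) ≡ᵇ evalWith Q (valuation s))
  where
  P = decode k a
  Q = decode k b
  σ  = natV r' ∷ natV a ∷ natV r ∷ natV k ∷ natV n ∷ library
  σ₁ = natV s ∷ natV b ∷ σ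
  σ₂ = polyV Q ∷ polyV P ∷ σ₁
  σ₃ = valuationAt s ∷ σ₂
  -- The selected branch already is the encoding of the result.
  selectResult : ∀ agree → app (app ⌜ boolV agree ⌝ ⌜ closure σ₃ someT ⌝) ⌜ closure σ₃ (lam (var 0)) ⌝
                           ≻* encResult (if agree then just (P , Q) else nothing)
  selectResult true  = select true  (closure σ₃ someT) (closure σ₃ (lam (var 0)))
  selectResult false = select false (closure σ₃ someT) (closure σ₃ (lam (var 0)))

enumerate₂-computes : ∀ n k r ar →
  app ⌜ pairV ar ⌝ ⌜ closure (natV r ∷ natV k ∷ natV n ∷ library) (lam readB) ⌝ ≻* encResult (enumerate₂ k ar)
enumerate₂-computes n k r (a , r') = casePair a r' (closure σ (lam readB)) ◅◅ β-closure₂ σ readB (natV a) (natV r')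
  ◅◅ appL* (unpair-computes r') ◅◅ enumerate₃-computes n k r a r' (unpair r')
  where σ = natV r ∷ natV k ∷ natV n ∷ library

enumerate₁-computes : ∀ n kr → app ⌜ pairV kr ⌝ ⌜ closure (natV n ∷ library) (lam readA) ⌝ ≻* encResult (enumerate₁ kr)
enumerate₁-computes n (k , r) = casePair k r (closure σ (lam readA)) ◅◅ β-closure₂ σ readA (natV k) (natV r)
  ◅◅ appL* (unpair-computes r) ◅◅ enumerate₂-computes n k r (unpair r)
  where σ = natV n ∷ library

enumerate-computes : ∀ n → app ⌜ enumerateV ⌝ (encNat n) ≻* encResult (enumerate n)
enumerate-computes n = β-closure library enumBody (natV n) ◅◅ appL* (unpair-computes n) ◅◅ enumerate₁-computes n (unpair n)

-- Every pair of numbers is reached by unpair; the proof walks the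
-- anti-diagonal x + y = d backwards to its start (0 , d), which follows the
-- end (d - 1 , 0) of the previous diagonal.
unpair-onto-diagonal : ∀ d x y → x + y ≡ d → ∃ λ n → unpair n ≡ (x , y)
unpair-onto-diagonal d (suc x) y on-d with unpair-onto-diagonal d x (suc y) (trans (+-suc x y) on-d)
... | n , reaches = suc n , cong step reaches
unpair-onto-diagonal zero    zero zero     _    = 0 , refl
unpair-onto-diagonal zero    zero (suc y) ()
unpair-onto-diagonal (suc d) zero zero    ()
unpair-onto-diagonal (suc d) zero (suc .d) refl with unpair-onto-diagonal d d 0 (+-identityʳ d)
... | n , reaches = suc n , cong step reaches

unpair-onto : ∀ x y → ∃ λ n → unpair n ≡ (x , y)
unpair-onto x y = unpair-onto-diagonal (x + y) x y refl

-- Every list S, read through nth, is a valuation: the empty list is coded by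
-- 0, and x ∷ S by a code of the pair (x , code of S).
valuation-zero : ∀ i → valuation 0 i ≡ 0
valuation-zero zero    = refl
valuation-zero (suc i) = valuation-zero i

valuation-onto : ∀ S → ∃ λ s → ∀ i → valuation s i ≡ nth S i
valuation-onto []      = 0 , valuation-zero
valuation-onto (x ∷ S) with valuation-onto S
... | t , t-codes-S with unpair-onto x t
... | s , s-unpairs = s , λ i → trans (cong (λ pr → valuationOf pr i) s-unpairs) (byPosition i)
  where
  byPosition : ∀ i → valuationOf (x , t) i ≡ nth (x ∷ S) i
  byPosition zero    = refl
  byPosition (suc i) = t-codes-S i

Code : Poly → Set
Code p = Σ ℕ λ m → Σ ℕ λ d → ∀ k → d ≤ k → decode k m ≡ p

code-binary : ∀ t {p q} → Code p → Code q → Code (binary t p q)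
code-binary t {p} {q} (m₁ , d₁ , decodes₁) (m₂ , d₂ , decodes₂) with unpair-onto m₁ m₂
... | r , r-unpairs with unpair-onto (suc (suc t)) r
... | m , m-unpairs = m , suc (d₁ + d₂) , decodes
  where
  open ≡-Reasoning
  decodes : ∀ k → suc (d₁ + d₂) ≤ k → decode k m ≡ binary t p q
  decodes (suc k) (s≤s enough) = begin
    decodeNode k (unpair m)                   ≡⟨ cong (decodeNode k) m-unpairs ⟩
    decodeBinary k t (unpair r)               ≡⟨ cong (decodeBinary k t) r-unpairs ⟩
    binary t (decode k m₁) (decode k m₂)
      ≡⟨ cong₂ (binary t) (decodes₁ k (m+n≤o⇒m≤o d₁ enough)) (decodes₂ k (m+n≤o⇒n≤o d₁ enough)) ⟩
    binary t p q                              ∎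

decode-onto : ∀ p → Code p
decode-onto (cst c) with unpair-onto 0 c
... | m , m-unpairs = m , 1 , λ { (suc k) _ → cong (decodeNode k) m-unpairs }
decode-onto (pvar c) with unpair-onto 1 c
... | m , m-unpairs = m , 1 , λ { (suc k) _ → cong (decodeNode k) m-unpairs }
decode-onto (add p q) = code-binary 0 (decode-onto p) (decode-onto q)
decode-onto (mul p q) = code-binary 1 (decode-onto p) (decode-onto q)

evalWith-nth : ∀ p {g} S → (∀ i → g i ≡ nth S i) → evalWith p g ≡ eval p S
evalWith-nth (cst n)   S g≗S = refl
evalWith-nth (pvar n)  S g≗S = g≗S n
evalWith-nth (add p q) S g≗S = cong₂ _+_ (evalWith-nth p S g≗S) (evalWith-nth q S g≗S)
evalWith-nth (mul p q) S g≗S = cong₂ _*_ (evalWith-nth p S g≗S) (evalWith-nth q S g≗S)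

-- Every variable index of p lies below varBound p, so a valuation can be cut
-- down to a list of that length without changing the value of p.
varBound : Poly → ℕ
varBound (cst _)   = 0
varBound (pvar n)  = suc n
varBound (add p q) = varBound p + varBound q
varBound (mul p q) = varBound p + varBound q

nth-applyUpTo : ∀ g N n → n < N → nth (applyUpTo g N) n ≡ g n
nth-applyUpTo g (suc N) zero    _        = refl
nth-applyUpTo g (suc N) (suc n) (s≤s lt) = nth-applyUpTo (λ i → g (suc i)) N n lt

eval-applyUpTo : ∀ p g N → varBound p ≤ N → eval p (applyUpTo g N) ≡ evalWith p g
eval-applyUpTo (cst n)   g N _      = refl
eval-applyUpTo (pvar n)  g N within = nth-applyUpTo g N n within
eval-applyUpTo (add p q) g N within =
  cong₂ _+_ (eval-applyUpTo p g N (m+n≤o⇒m≤o (varBound p) within)) (eval-applyUpTo q g N (m+n≤o⇒n≤o (varBound p) within))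
eval-applyUpTo (mul p q) g N within =
  cong₂ _*_ (eval-applyUpTo p g N (m+n≤o⇒m≤o (varBound p) within)) (eval-applyUpTo q g N (m+n≤o⇒n≤o (varBound p) within))

-- Whatever check outputs is a solvable instance: the witness is the checked
-- valuation cut down to the variables of P and Q.
check-sound : ∀ P Q s z → check P Q s ≡ just z → H10 z
check-sound P Q s z outputs with evalWith P (valuation s) ≡ᵇ evalWith Q (valuation s) in agree
check-sound P Q s .(P , Q) refl | true = applyUpTo g N , (begin
  eval P (applyUpTo g N) ≡⟨ eval-applyUpTo P g N (m≤m+n (varBound P) (varBound Q)) ⟩
  evalWith P g           ≡⟨ ≡ᵇ⇒≡ _ _ (Equivalence.from T-≡ agree) ⟩
  evalWith Q g           ≡⟨ eval-applyUpTo Q g N (m≤n+m (varBound Q) (varBound P)) ⟨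
  eval Q (applyUpTo g N) ∎)
  where
  open ≡-Reasoning
  g = valuation s
  N = varBound P + varBound Q

check-complete : ∀ P Q s → evalWith P (valuation s) ≡ evalWith Q (valuation s) → check P Q s ≡ just (P , Q)
check-complete P Q s same = cong (λ agree → if agree then just (P , Q) else nothing) (Equivalence.to T-≡ (≡⇒≡ᵇ _ _ same))

enumerate-sound : ∀ z → (∃ λ n → enumerate n ≡ just z) → H10 z
enumerate-sound z (n , outputs) = check-sound _ _ valuationCode z outputs
  where
  valuationCode : ℕ
  valuationCode = proj₂ (unpair (proj₂ (unpair (proj₂ (unpair n)))))

enumerate-reaches : ∀ k a b s → ∃ λ n → enumerate n ≡ check (decode k a) (decode k b) s
enumerate-reaches k a b s with unpair-onto b s
... | r' , r'-unpairs with unpair-onto a r'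
... | r , r-unpairs with unpair-onto k r
... | n , n-unpairs = n , (begin
  enumerate₁ (unpair n)        ≡⟨ cong enumerate₁ n-unpairs ⟩
  enumerate₂ k (unpair r)      ≡⟨ cong (enumerate₂ k) r-unpairs ⟩
  enumerate₃ k a (unpair r')   ≡⟨ cong (enumerate₃ k a) r'-unpairs ⟩
  check (decode k a) (decode k b) s ∎)
  where open ≡-Reasoning

-- Every solvable instance is output: code the solution S as a valuation and
-- P, Q by codes decoding correctly with a common fuel.
enumerate-complete : ∀ z → H10 z → ∃ λ n → enumerate n ≡ just z
enumerate-complete (P , Q) (S , solves) with valuation-onto S | decode-onto P | decode-onto Q
... | s , s-codes-S | a , d₁ , decodes-P | b , d₂ , decodes-Q with enumerate-reaches (d₁ + d₂) a b s
... | n , reaches = n , (begin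
  enumerate n                                     ≡⟨ reaches ⟩
  check (decode (d₁ + d₂) a) (decode (d₁ + d₂) b) s
    ≡⟨ cong₂ (λ P' Q' → check P' Q' s) (decodes-P _ (m≤m+n d₁ d₂)) (decodes-Q _ (m≤n+m d₂ d₁)) ⟩
  check P Q s                                     ≡⟨ check-complete P Q s agree ⟩
  just (P , Q)                                    ∎)
  where
  open ≡-Reasoning
  agree : evalWith P (valuation s) ≡ evalWith Q (valuation s)
  agree = trans (evalWith-nth P S s-codes-S) (trans solves (sym (evalWith-nth Q S s-codes-S)))

mainTheorem2 : LEnumerable (encPair encPoly encPoly) H10
mainTheorem2 =
  enumerate ,
  (⌜ enumerateV ⌝ , proj₂ enumerateV , λ n → encResult (enumerate n) , enumerate-computes n , refl) ,
  λ z → mk⇔ (enumerate-complete z) (enumerate-sound z)
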